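{- Let $n>0$ be even and let $1\le k<k'\le n$ with $k'$ odd. Write $n=n_{j-1}\cdots n_1n_0$ and $k=k_{j-1}\cdots k_1k_0$ in binary, with $n_i,k_i\in\{0,1\}$ for $0\le i<j$. Let $P:=\binom{[n]}{k}\cup\binom{[n]}{k'}$, partially ordered by inclusion, where $[n]=\{1,\dots,n\}$ and $\binom{[n]}{m}$ is the set of $m$-element subsets of $[n]$. Then the Grundy number of the poset game $P$ is $$g(P)=\begin{cases}0 & \text{if } k_i>n_i \text{ for some } 0\le i<j,\\ 1 & \text{otherwise.}\end{cases}$$ In particular, if $k$ is even then $g(P)=\binom{n/2}{k/2}\bmod 2$.
   Context: A poset game on a finite poset $P$: two players alternate moves; a move consists of choosing a point $x$ of the remaining poset and removing every $y$ with $x\le y$; the first player unable to move loses. For an impartial game $G$, its Grundy number is defined recursively as $g(G)=\operatorname{mex}\{g(G') : G' \text{ an option of } G\}$, where $\operatorname{mex}A$ is the least natural number not in $A$; for a poset game, the options of $P$ are the posets $P_x=\{y\in P: x\not\le y\}$ for $x\in P$. -}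

module Defs where

open import Data.Nat using (ℕ; zero; suc; _/_; _%_; _^_)
open import Data.Nat.Properties using (_≟_)
open import Data.Bool using (Bool; true; false; if_then_else_)
open import Data.List using (List; []; _∷_; length; map; filter; _++_)
open import Data.Vec using (_∷_; [])
open import Data.Fin.Subset using (Subset; _⊆_; ∣_∣; inside; outside)
open import Data.Fin.Subset.Properties using (_⊆?_)
open import Data.List.Membership.DecPropositional _≟_ using (_∈?_)
open import Relation.Nullary using (¬?; does)

-- mex A : least natural number not in the (finite) list A.
-- Among 0,1,...,length A some value is missing, so length A + 1 candidates suffice.
mexFrom : List ℕ → ℕ → ℕ → ℕ
mexFrom A zero    m = m
mexFrom A (suc f) m = if does (m ∈? A) then mexFrom A f (suc m) else m

mex : List ℕ → ℕ
mex A = mexFrom A (length A) 0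

-- A finite poset of subsets of [n] ordered by inclusion, given as a
-- duplicate-free list of its elements.
-- Option of P at x : P_x = { y ∈ P : ¬ (x ⊆ y) }.
option : ∀ {n} → Subset n → List (Subset n) → List (Subset n)
option x P = filter (λ y → ¬? (x ⊆? y)) P

-- Grundy number of the poset game, by recursion with fuel;
-- each option removes at least x itself, so fuel = length P suffices.
grundyFuel : ∀ {n} → ℕ → List (Subset n) → ℕ
grundyFuel zero    P = 0
grundyFuel (suc f) P = mex (map (λ x → grundyFuel f (option x P)) P)

grundy : ∀ {n} → List (Subset n) → ℕ
grundy P = grundyFuel (length P) P

allSubsets : (n : ℕ) → List (Subset n)
allSubsets zero    = [] ∷ []
allSubsets (suc n) = map (outside ∷_) (allSubsets n) ++ map (inside ∷_) (allSubsets n)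

choose : (n m : ℕ) → List (Subset n)
choose n m = filter (λ s → ∣ s ∣ ≟ m) (allSubsets n)

levels : (n k k' : ℕ) → List (Subset n)
levels n k k' = choose n k ++ choose n k'

bit : ℕ → ℕ → ℕ
bit zero    m = m % 2
bit (suc i) m = bit i (m / 2)

-- Let σ swap the points 2i and 2i+1 of [n]. It is an involutive automorphism of P whose fixed
-- points are the unions of pairs, so they have even size: they lie in the k-level, where they are
-- minimal, and x ⊆ σ x forces x = σ x. For any such σ-symmetric family Q, g(Q) is the parity of
-- the number of fixed points: a move at a non-fixed x is answered by σ x, which leaves the fixed
-- points untouched, and a move at a fixed point removes that point and no other. The fixed
-- points of P number C(n/2, k/2) when k is even and 0 when k is odd, in both cases ≡ C(n, k)
-- mod 2, and Lucas's theorem mod 2 turns the parity of C(n, k) into the digit condition.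
module Submission where

open import Defs
open import Data.Nat using (ℕ; _<_; _≤_; _>_; _/_; _%_)
open import Data.Nat.Divisibility using (_∣_)
open import Data.Nat.Combinatorics using (_C_)
open import Data.Product using (_×_; ∃-syntax)
open import Relation.Nullary using (¬_)
open import Relation.Binary.PropositionalEquality using (_≡_)

open import Data.Nat
open import Data.Nat.Properties
open import Data.Nat.DivMod using (m*n/n≡m; m*n%n≡0; [m+kn]%n≡m%n; m/n≡1+[m∸n]/n; m/n<m; m%n<n)
open import Data.Nat.Divisibility using (divides; n∣m⇒m%n≡0)
open import Data.Nat.Induction using (<-wellFounded; <-rec)
open import Data.Nat.Combinatorics using (nCk+nC[k+1]≡[n+1]C[k+1])
open import Data.Parity.Base as ℙ using (Parity; 0ℙ; 1ℙ)
open import Data.Parity.Properties as ℙ using (+-homo-+)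
open import Data.Bool using (Bool; true; false; _∧_; if_then_else_)
import Data.Bool.Properties as Bool
open import Data.Empty using (⊥-elim)
open import Data.Fin using (zero)
open import Data.Fin.Subset as Subset using (Subset; _⊆_; ∣_∣; inside; outside)
open import Data.Fin.Subset.Properties using (_⊆?_; ⊆-refl; drop-∷-⊆; drop-there; p⊆q⇒∣p∣≤∣q∣)
open import Data.Vec.Base using (_∷_; []; here; there)
import Data.Vec.Properties as Vec
open import Data.List using (List; []; _∷_; length; map; filter; _++_)
open import Data.List.Properties using (filter-notAll)
open import Data.List.Membership.Propositional using (_∈_)
open import Data.List.Membership.Propositional.Properties
  using (∈-filter⁻; ∈-filter⁺; ∈-map⁺; ∈-map⁻; ∈-++⁺ˡ; ∈-++⁺ʳ; ∈-++⁻)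
open import Data.List.Membership.DecPropositional _≟_ using (_∈?_)
open import Data.List.Relation.Unary.Any using (here; there)
import Data.List.Relation.Unary.Any as Any
import Data.List.Relation.Unary.All as All
open import Data.List.Relation.Unary.AllPairs using ([]; _∷_)
open import Data.List.Relation.Unary.Unique.Propositional using (Unique)
open import Data.List.Relation.Unary.Unique.Propositional.Properties using (filter⁺; ++⁺; map⁺)
open import Data.Product using (_,_; proj₁; proj₂)
open import Data.Sum as Sum using (_⊎_; inj₁; inj₂)
open import Induction.WellFounded using (Acc; acc)
open import Relation.Nullary using (Dec; yes; no; ¬?; does; contradiction)
open import Relation.Binary.PropositionalEquality

-- Lucas's theorem modulo 2

data Halving : ℕ → Set where
  even : ∀ a → Halving (a * 2)
  odd  : ∀ a → Halving (suc (a * 2))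

halving : ∀ m → Halving m
halving zero = even 0
halving (suc m) with halving m
... | even a = odd a
... | odd a  = even (suc a)

half : ∀ {m} → Halving m → ℕ
half (even a) = a
half (odd a)  = a

[a*2]/2≡a : ∀ a → a * 2 / 2 ≡ a
[a*2]/2≡a a = m*n/n≡m a 2

[1+a*2]/2≡a : ∀ a → suc (a * 2) / 2 ≡ a
[1+a*2]/2≡a zero    = refl
[1+a*2]/2≡a (suc a) =
  trans (m/n≡1+[m∸n]/n {suc (suc (suc (a * 2)))} (s≤s (s≤s z≤n))) (cong suc ([1+a*2]/2≡a a))

m/2≡half : ∀ {m} (h : Halving m) → m / 2 ≡ half h
m/2≡half (even a) = [a*2]/2≡a a
m/2≡half (odd a)  = [1+a*2]/2≡a a

bit0[a*2]≡0 : ∀ a → bit 0 (a * 2) ≡ 0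
bit0[a*2]≡0 a = m*n%n≡0 a 2

bit0[1+a*2]≡1 : ∀ a → bit 0 (suc (a * 2)) ≡ 1
bit0[1+a*2]≡1 a = [m+kn]%n≡m%n 1 a 2

parity≡⇒%2≡ : ∀ m n → parity m ≡ parity n → m % 2 ≡ n % 2
parity≡⇒%2≡ m n eq = trans (%2≡ m) (trans (cong toℕ eq) (sym (%2≡ n)))
  where
  toℕ : Parity → ℕ
  toℕ 0ℙ = 0
  toℕ 1ℙ = 1
  %2≡ : ∀ m → m % 2 ≡ toℕ (parity m)
  %2≡ 0             = refl
  %2≡ 1             = refl
  %2≡ (suc (suc m)) = %2≡ m

[1+m]%2≢m%2 : ∀ m → suc m % 2 ≢ m % 2
[1+m]%2≢m%2 0             = λ ()
[1+m]%2≢m%2 1             = λ ()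
[1+m]%2≢m%2 (suc (suc m)) = [1+m]%2≢m%2 m

[1+m]%2≡1⇒m%2≡0 : ∀ m → suc m % 2 ≡ 1 → m % 2 ≡ 0
[1+m]%2≡1⇒m%2≡0 0             _  = refl
[1+m]%2≡1⇒m%2≡0 (suc (suc m)) eq = [1+m]%2≡1⇒m%2≡0 m eq

m%2≤1 : ∀ m → m % 2 ≤ 1
m%2≤1 m = ≤-pred (m%n<n m 2)

m%2≡1⇒0<m : ∀ m → m % 2 ≡ 1 → 0 < m
m%2≡1⇒0<m (suc m) _ = s≤s z≤n

parity-pascal : ∀ n k → parity (suc n C suc k) ≡ parity (n C k) ℙ.+ parity (n C suc k)
parity-pascal n k =
  trans (cong parity (sym (nCk+nC[k+1]≡[n+1]C[k+1] n k))) (+-homo-+ (n C k) (n C suc k))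

parity-[a*2]C[b*2]     : ∀ a b → parity (a * 2 C b * 2) ≡ parity (a C b)
parity-[a*2]C[1+b*2]   : ∀ a b → parity (a * 2 C suc (b * 2)) ≡ 0ℙ
parity-[1+a*2]C[b*2]   : ∀ a b → parity (suc (a * 2) C b * 2) ≡ parity (a C b)
parity-[1+a*2]C[1+b*2] : ∀ a b → parity (suc (a * 2) C suc (b * 2)) ≡ parity (a C b)

parity-[a*2]C[b*2] zero    zero    = refl
parity-[a*2]C[b*2] zero    (suc b) = refl
parity-[a*2]C[b*2] (suc a) zero    = refl
parity-[a*2]C[b*2] (suc a) (suc b) = begin
  parity (suc a * 2 C suc b * 2)
    ≡⟨ parity-pascal (suc (a * 2)) (suc (b * 2)) ⟩
  parity (suc (a * 2) C suc (b * 2)) ℙ.+ parity (suc (a * 2) C suc b * 2)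
    ≡⟨ cong₂ ℙ._+_ (parity-[1+a*2]C[1+b*2] a b) (parity-[1+a*2]C[b*2] a (suc b)) ⟩
  parity (a C b) ℙ.+ parity (a C suc b)
    ≡⟨ parity-pascal a b ⟨
  parity (suc a C suc b) ∎
  where open ≡-Reasoning

parity-[a*2]C[1+b*2] zero    b = refl
parity-[a*2]C[1+b*2] (suc a) b = begin
  parity (suc a * 2 C suc (b * 2))
    ≡⟨ parity-pascal (suc (a * 2)) (b * 2) ⟩
  parity (suc (a * 2) C b * 2) ℙ.+ parity (suc (a * 2) C suc (b * 2))
    ≡⟨ cong₂ ℙ._+_ (parity-[1+a*2]C[b*2] a b) (parity-[1+a*2]C[1+b*2] a b) ⟩
  parity (a C b) ℙ.+ parity (a C b)
    ≡⟨ proj₁ ℙ.+-inverse (parity (a C b)) ⟩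
  0ℙ ∎
  where open ≡-Reasoning

parity-[1+a*2]C[b*2] a zero    = refl
parity-[1+a*2]C[b*2] a (suc b) = begin
  parity (suc (a * 2) C suc b * 2)
    ≡⟨ parity-pascal (a * 2) (suc (b * 2)) ⟩
  parity (a * 2 C suc (b * 2)) ℙ.+ parity (a * 2 C suc b * 2)
    ≡⟨ cong₂ ℙ._+_ (parity-[a*2]C[1+b*2] a b) (parity-[a*2]C[b*2] a (suc b)) ⟩
  parity (a C suc b) ∎
  where open ≡-Reasoning

parity-[1+a*2]C[1+b*2] a b = begin
  parity (suc (a * 2) C suc (b * 2))
    ≡⟨ parity-pascal (a * 2) (b * 2) ⟩
  parity (a * 2 C b * 2) ℙ.+ parity (a * 2 C suc (b * 2))
    ≡⟨ cong₂ ℙ._+_ (parity-[a*2]C[b*2] a b) (parity-[a*2]C[1+b*2] a b) ⟩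
  parity (a C b) ℙ.+ 0ℙ
    ≡⟨ ℙ.+-identityʳ (parity (a C b)) ⟩
  parity (a C b) ∎
  where open ≡-Reasoning

parity-C-halving : ∀ {m j} (hm : Halving m) (hj : Halving j) →
                   bit 0 j ≤ bit 0 m → parity (m C j) ≡ parity (half hm C half hj)
parity-C-halving (even a) (even b) _   = parity-[a*2]C[b*2] a b
parity-C-halving (even a) (odd b)  1≤0 =
  contradiction (subst₂ _≤_ (bit0[1+a*2]≡1 b) (bit0[a*2]≡0 a) 1≤0) λ ()
parity-C-halving (odd a)  (even b) _   = parity-[1+a*2]C[b*2] a b
parity-C-halving (odd a)  (odd b)  _   = parity-[1+a*2]C[1+b*2] a b

parity-C-halve : ∀ m j → bit 0 j ≤ bit 0 m → parity (m C j) ≡ parity (m / 2 C j / 2)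
parity-C-halve m j bits≤ = begin
  parity (m C j)               ≡⟨ parity-C-halving hm hj bits≤ ⟩
  parity (half hm C half hj)   ≡⟨ cong₂ (λ x y → parity (x C y)) (m/2≡half hm) (m/2≡half hj) ⟨
  parity (m / 2 C j / 2)       ∎
  where
  open ≡-Reasoning
  hm : Halving m
  hm = halving m
  hj : Halving j
  hj = halving j

parity-C-bit0< : ∀ m j → bit 0 m < bit 0 j → parity (m C j) ≡ 0ℙ
parity-C-bit0< m j bits< with halving m | halving j
... | even a | odd b  = parity-[a*2]C[1+b*2] a b
... | even a | even b =
  contradiction (subst₂ _<_ (bit0[a*2]≡0 a) (bit0[a*2]≡0 b) bits<) λ ()
... | odd a  | even b =
  contradiction (subst₂ _<_ (bit0[1+a*2]≡1 a) (bit0[a*2]≡0 b) bits<) λ ()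
... | odd a  | odd b  =
  contradiction (subst₂ _<_ (bit0[1+a*2]≡1 a) (bit0[1+a*2]≡1 b) bits<) λ { (s≤s ()) }

bit<⇒parity[C]≡0ℙ : ∀ i m j → bit i m < bit i j → parity (m C j) ≡ 0ℙ
bit<⇒parity[C]≡0ℙ zero    m j bits< = parity-C-bit0< m j bits<
bit<⇒parity[C]≡0ℙ (suc i) m j bits< with bit 0 m <? bit 0 j
... | yes bits0< = parity-C-bit0< m j bits0<
... | no  bits0≮ =
  trans (parity-C-halve m j (≮⇒≥ bits0≮)) (bit<⇒parity[C]≡0ℙ i (m / 2) (j / 2) bits<)

parity[C]≡0ℙ⇒bit< : ∀ m j → parity (m C j) ≡ 0ℙ → ∃[ i ] bit i m < bit i j
parity[C]≡0ℙ⇒bit< m j = go m j (<-wellFounded j)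
  where
  go : ∀ m j → Acc _<_ j → parity (m C j) ≡ 0ℙ → ∃[ i ] bit i m < bit i j
  go m zero _ 1ℙ≡0ℙ = contradiction 1ℙ≡0ℙ λ ()
  go m (suc j) (acc rec) ≡0ℙ with bit 0 m <? bit 0 (suc j)
  ... | yes bits0< = 0 , bits0<
  ... | no  bits0≮ with go (m / 2) (suc j / 2) (rec (m/n<m (suc j) 2 (s≤s (s≤s z≤n))))
                           (trans (sym (parity-C-halve m (suc j) (≮⇒≥ bits0≮))) ≡0ℙ)
  ...   | i , bits< = suc i , bits<

0<bit⇒< : ∀ i m → 0 < bit i m → i < m
0<bit⇒< zero    (suc m) _   = s≤s z≤n
0<bit⇒< (suc i) zero    pos = contradiction (0<bit⇒< i zero pos) λ ()
0<bit⇒< (suc i) (suc m) pos =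
  ≤-<-trans (0<bit⇒< i (suc m / 2) pos) (m/n<m (suc m) 2 (s≤s (s≤s z≤n)))

nCk%2≡[n/2]C[k/2]%2 : ∀ n k → 2 ∣ k → (n C k) % 2 ≡ (n / 2 C k / 2) % 2
nCk%2≡[n/2]C[k/2]%2 n k 2∣k = parity≡⇒%2≡ (n C k) (n / 2 C k / 2) (parity-C-halve n k bits≤)
  where
  bits≤ : bit 0 k ≤ bit 0 n
  bits≤ = subst (_≤ bit 0 n) (sym (n∣m⇒m%n≡0 k 2 2∣k)) z≤n

mexFrom-∉ : ∀ {A m} f → ¬ m ∈ A → mexFrom A (suc f) m ≡ m
mexFrom-∉ {A} {m} f m∉A with m ∈? A
... | yes m∈A = contradiction m∈A m∉A
... | no  _   = refl

mexFrom-∈ : ∀ {A m} f → m ∈ A → mexFrom A (suc f) m ≡ mexFrom A f (suc m)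
mexFrom-∈ {A} {m} f m∈A with m ∈? A
... | yes _   = refl
... | no  m∉A = contradiction m∈A m∉A

m≤mexFrom : ∀ A f m → m ≤ mexFrom A f m
m≤mexFrom A zero    m = ≤-refl
m≤mexFrom A (suc f) m with m ∈? A
... | yes _ = <⇒≤ (m≤mexFrom A f (suc m))
... | no  _ = ≤-refl

-- Only the values 0 and 1 are needed; for larger values, knowing that the fuel length A of mex
-- suffices would take a pigeonhole argument.
mex≡ : ∀ {A b} → b ≤ 1 → ¬ b ∈ A → (b ≡ 1 → 0 ∈ A) → mex A ≡ b
mex≡ {[]}        z≤n       _   _   = refl
mex≡ {a ∷ A}     z≤n       0∉A _   = mexFrom-∉ (length A) 0∉A
mex≡ {[]}        (s≤s z≤n) _   0∈A = contradiction (0∈A refl) λ ()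
mex≡ {a ∷ []}    (s≤s z≤n) _   0∈A = mexFrom-∈ 0 (0∈A refl)
mex≡ {a ∷ b ∷ A} (s≤s z≤n) 1∉A 0∈A =
  trans (mexFrom-∈ (suc (length A)) (0∈A refl)) (mexFrom-∉ (length A) 1∉A)

mex≢ : ∀ {A b} → b ≤ 1 → b ∈ A → mex A ≢ b
mex≢ {a ∷ A} z≤n 0∈A mex≡0 = contradiction 1≤0 λ ()
  where
  1≤0 : 1 ≤ 0
  1≤0 = subst (1 ≤_) (trans (sym (mexFrom-∈ (length A) 0∈A)) mex≡0) (m≤mexFrom (a ∷ A) (length A) 1)
mex≢ {a ∷ A} (s≤s z≤n) 1∈A mex≡1 with 0 ∈? (a ∷ A)
... | no  0∉A = contradiction (trans (sym (mexFrom-∉ (length A) 0∉A)) mex≡1) λ ()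
mex≢ {a ∷ []}    (s≤s z≤n) (here refl) mex≡1 | yes (here ())
mex≢ {a ∷ b ∷ A} (s≤s z≤n) 1∈A         mex≡1 | yes 0∈A = contradiction 2≤1 λ { (s≤s ()) }
  where
  mex≡mexFrom2 : mex (a ∷ b ∷ A) ≡ mexFrom (a ∷ b ∷ A) (length A) 2
  mex≡mexFrom2 = trans (mexFrom-∈ (suc (length A)) 0∈A) (mexFrom-∈ (length A) 1∈A)
  2≤1 : 2 ≤ 1
  2≤1 = subst (2 ≤_) (trans (sym mex≡mexFrom2) mex≡1) (m≤mexFrom (a ∷ b ∷ A) (length A) 2)

-- Symmetric poset games

count : ∀ {A : Set} → (A → Bool) → List A → ℕ
count p []       = 0
count p (x ∷ xs) = if p x then suc (count p xs) else count p xs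

count-++ : ∀ {A : Set} (p : A → Bool) xs ys → count p (xs ++ ys) ≡ count p xs + count p ys
count-++ p []       ys = refl
count-++ p (x ∷ xs) ys with p x
... | true  = cong suc (count-++ p xs ys)
... | false = count-++ p xs ys

count-map : ∀ {A B : Set} (p : B → Bool) (f : A → B) xs →
            count p (map f xs) ≡ count (λ x → p (f x)) xs
count-map p f []       = refl
count-map p f (x ∷ xs) with p (f x)
... | true  = cong suc (count-map p f xs)
... | false = count-map p f xs

count-filter : ∀ {A : Set} {P : A → Set} (p : A → Bool) P? xs →
               count p (filter {P = P} P? xs) ≡ count (λ x → p x ∧ does (P? x)) xs
count-filter p P? []       = refl
count-filter p P? (x ∷ xs) with does (P? x)
... | false rewrite Bool.∧-zeroʳ (p x) = count-filter p P? xs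
... | true  with p x
...   | true  = cong suc (count-filter p P? xs)
...   | false = count-filter p P? xs

count-none : ∀ {A : Set} (p : A → Bool) → (∀ x → p x ≡ false) → ∀ xs → count p xs ≡ 0
count-none p none []       = refl
count-none p none (x ∷ xs) rewrite none x = count-none p none xs

∈-option⁻ : ∀ {n} {x y : Subset n} {Q} → y ∈ option x Q → y ∈ Q × ¬ x ⊆ y
∈-option⁻ {x = x} = ∈-filter⁻ (λ y → ¬? (x ⊆? y))

∈-option⁺ : ∀ {n} {x y : Subset n} {Q} → y ∈ Q → ¬ x ⊆ y → y ∈ option x Q
∈-option⁺ {x = x} = ∈-filter⁺ (λ y → ¬? (x ⊆? y))

option-unique : ∀ {n} {x : Subset n} {Q} → Unique Q → Unique (option x Q)
option-unique {x = x} = filter⁺ (λ y → ¬? (x ⊆? y))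

length-option< : ∀ {n} {x : Subset n} {Q} → x ∈ Q → length (option x Q) < length Q
length-option< {x = x} {Q} x∈Q =
  filter-notAll (λ y → ¬? (x ⊆? y)) Q (Any.map (λ { refl x⊈x → x⊈x ⊆-refl }) x∈Q)

module Mirror {n} (σ : Subset n → Subset n)
                  (σ-involutive : ∀ x → σ (σ x) ≡ x)
                  (σ-mono : ∀ {x y} → x ⊆ y → σ x ⊆ σ y) where

  Fixed : Subset n → Set
  Fixed x = σ x ≡ x

  fixed? : ∀ x → Dec (Fixed x)
  fixed? x = Vec.≡-dec Bool._≟_ (σ x) x

  #fixed : List (Subset n) → ℕ
  #fixed = count (λ x → does (fixed? x))

  Closed : List (Subset n) → Set
  Closed Q = ∀ {x} → x ∈ Q → σ x ∈ Q

  record Mirrored (Q : List (Subset n)) : Set where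
    field
      unique        : Unique Q
      closed        : Closed Q
      fixed-minimal : ∀ {x y} → x ∈ Q → y ∈ Q → Fixed y → x ⊆ y → x ≡ y
      ⊆σ⇒fixed      : ∀ {x} → x ∈ Q → x ⊆ σ x → Fixed x

  ⊆σ⇒σ⊆ : ∀ {x y} → x ⊆ σ y → σ x ⊆ y
  ⊆σ⇒σ⊆ {x} {y} x⊆σy = subst (σ x ⊆_) (σ-involutive y) (σ-mono x⊆σy)

  fixed-σ⇒fixed : ∀ {x} → Fixed (σ x) → Fixed x
  fixed-σ⇒fixed {x} fσx = sym (trans (sym (σ-involutive x)) fσx)

  mirrored-sublist : ∀ {Q Q′} → Mirrored Q → Unique Q′ → (∀ {y} → y ∈ Q′ → y ∈ Q) →
                     Closed Q′ → Mirrored Q′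
  mirrored-sublist mQ u sub cl = record
    { unique        = u
    ; closed        = cl
    ; fixed-minimal = λ x∈ y∈ → fixed-minimal (sub x∈) (sub y∈)
    ; ⊆σ⇒fixed      = λ x∈ → ⊆σ⇒fixed (sub x∈)
    }
    where open Mirrored mQ

  mirrored-option-fixed : ∀ {Q x} → Mirrored Q → Fixed x → Mirrored (option x Q)
  mirrored-option-fixed {Q} {x} mQ fx =
    mirrored-sublist mQ (option-unique unique) (λ y∈ → proj₁ (∈-option⁻ y∈)) closed′
    where
    open Mirrored mQ
    closed′ : Closed (option x Q)
    closed′ y∈ with ∈-option⁻ y∈
    ... | y∈Q , x⊈y = ∈-option⁺ (closed y∈Q) λ x⊆σy → x⊈y (subst (_⊆ _) fx (⊆σ⇒σ⊆ x⊆σy))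

  mirrored-option-pair : ∀ {Q x} → Mirrored Q → Mirrored (option (σ x) (option x Q))
  mirrored-option-pair {Q} {x} mQ =
    mirrored-sublist mQ (option-unique (option-unique unique))
                     (λ y∈ → proj₁ (∈-option⁻ (proj₁ (∈-option⁻ y∈)))) closed′
    where
    open Mirrored mQ
    closed′ : Closed (option (σ x) (option x Q))
    closed′ y∈ with ∈-option⁻ y∈
    ... | y∈Q₁ , σx⊈y with ∈-option⁻ y∈Q₁
    ...   | y∈Q , x⊈y =
      ∈-option⁺ (∈-option⁺ (closed y∈Q) λ x⊆σy → σx⊈y (⊆σ⇒σ⊆ x⊆σy))
                λ σx⊆σy → x⊈y (subst (_⊆ _) (σ-involutive x) (⊆σ⇒σ⊆ σx⊆σy))

  #fixed-option-≡ : ∀ {x} Q → (∀ {y} → y ∈ Q → Fixed y → ¬ x ⊆ y) →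
                    #fixed (option x Q) ≡ #fixed Q
  #fixed-option-≡ []      _ = refl
  #fixed-option-≡ {x} (y ∷ Q) below with x ⊆? y
  ... | yes x⊆y with fixed? y
  ...   | yes fy = ⊥-elim (below (here refl) fy x⊆y)
  ...   | no  _  = #fixed-option-≡ Q (λ y∈ → below (there y∈))
  #fixed-option-≡ {x} (y ∷ Q) below | no _ with fixed? y
  ...   | yes _ = cong suc (#fixed-option-≡ Q (λ y∈ → below (there y∈)))
  ...   | no  _ = #fixed-option-≡ Q (λ y∈ → below (there y∈))

  #fixed-option-suc : ∀ {x} Q → Unique Q → x ∈ Q → Fixed x →
                      (∀ {y} → y ∈ Q → Fixed y → x ⊆ y → y ≡ x) →
                      suc (#fixed (option x Q)) ≡ #fixed Q
  #fixed-option-suc {x} (x ∷ Q) (x∉Q ∷ _) (here refl) fx above with x ⊆? x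
  ... | no  x⊈x = ⊥-elim (x⊈x ⊆-refl)
  ... | yes _ with fixed? x
  ...   | no  ¬fx = contradiction fx ¬fx
  ...   | yes _   = cong suc (#fixed-option-≡ Q λ y∈Q fy x⊆y →
                                 All.lookup x∉Q y∈Q (sym (above (there y∈Q) fy x⊆y)))
  #fixed-option-suc {x} (y ∷ Q) (y∉Q ∷ u) (there x∈Q) fx above with x ⊆? y
  ... | yes x⊆y with fixed? y
  ...   | yes fy = contradiction (above (here refl) fy x⊆y) (All.lookup y∉Q x∈Q)
  ...   | no  _  = #fixed-option-suc Q u x∈Q fx (λ y∈ → above (there y∈))
  #fixed-option-suc {x} (y ∷ Q) (y∉Q ∷ u) (there x∈Q) fx above | no _ with fixed? y
  ...   | yes _ = cong suc (#fixed-option-suc Q u x∈Q fx (λ y∈ → above (there y∈)))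
  ...   | no  _ = #fixed-option-suc Q u x∈Q fx (λ y∈ → above (there y∈))

  0<#fixed⇒∃-fixed : ∀ Q → 0 < #fixed Q → ∃[ x ] (x ∈ Q × Fixed x)
  0<#fixed⇒∃-fixed (y ∷ Q) pos with fixed? y
  ... | yes fy = y , here refl , fy
  ... | no  _  with 0<#fixed⇒∃-fixed Q pos
  ...   | x , x∈Q , fx = x , there x∈Q , fx

  σ∈option : ∀ {Q x} → Mirrored Q → x ∈ Q → ¬ Fixed x → σ x ∈ option x Q
  σ∈option mQ x∈Q ¬fx = ∈-option⁺ (closed x∈Q) (λ x⊆σx → ¬fx (⊆σ⇒fixed x∈Q x⊆σx))
    where open Mirrored mQ

  no-fixed-above : ∀ {Q x} → Mirrored Q → x ∈ Q → ¬ Fixed x →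
                   ∀ {y} → y ∈ Q → Fixed y → ¬ x ⊆ y
  no-fixed-above mQ x∈Q ¬fx y∈Q fy x⊆y = ¬fx (subst Fixed (sym (fixed-minimal x∈Q y∈Q fy x⊆y)) fy)
    where open Mirrored mQ

  GrundyParity : ℕ → Set
  GrundyParity f = ∀ {Q} → length Q ≤ f → Mirrored Q → grundyFuel f Q ≡ #fixed Q % 2

  -- The answer σ x leaves the fixed points of Q in place, so by induction it has value
  -- #fixed Q % 2, which the mex then avoids.
  mirror-move≢ : ∀ {f Q x} → (∀ {g} → g < f → GrundyParity g) → length Q ≤ suc f → Mirrored Q →
                 x ∈ Q → ¬ Fixed x → grundyFuel f (option x Q) ≢ #fixed Q % 2
  mirror-move≢ {zero} _ len mQ x∈Q ¬fx =
    contradiction (≤-trans (≤-<-trans z≤n (length-option< (σ∈option mQ x∈Q ¬fx)))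
                           (≤-pred (≤-trans (length-option< x∈Q) len))) λ ()
  mirror-move≢ {suc f} {Q} {x} ih len mQ x∈Q ¬fx =
    mex≢ (m%2≤1 (#fixed Q)) (subst (_∈ map answer Q₁) answer≡ (∈-map⁺ answer σx∈Q₁))
    where
    Q₁ Q₂ : List (Subset n)
    Q₁ = option x Q
    Q₂ = option (σ x) Q₁
    answer : Subset n → ℕ
    answer y = grundyFuel f (option y Q₁)
    σx∈Q₁ : σ x ∈ Q₁
    σx∈Q₁ = σ∈option mQ x∈Q ¬fx
    len₂ : length Q₂ ≤ f
    len₂ = ≤-pred (≤-pred (≤-trans (s≤s (length-option< σx∈Q₁))
                                   (≤-trans (length-option< x∈Q) len)))
    #fixed₂ : #fixed Q₂ ≡ #fixed Q
    #fixed₂ = trans (#fixed-option-≡ Q₁ λ y∈Q₁ → σx-below (proj₁ (∈-option⁻ y∈Q₁)))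
                    (#fixed-option-≡ Q (no-fixed-above mQ x∈Q ¬fx))
      where
      σx-below : ∀ {y} → y ∈ Q → Fixed y → ¬ σ x ⊆ y
      σx-below = no-fixed-above mQ (Mirrored.closed mQ x∈Q) (λ fσx → ¬fx (fixed-σ⇒fixed fσx))
    answer≡ : grundyFuel f Q₂ ≡ #fixed Q % 2
    answer≡ = trans (ih ≤-refl len₂ (mirrored-option-pair mQ)) (cong (_% 2) #fixed₂)

  grundyFuel-suc : ∀ {f} → (∀ {g} → g < suc f → GrundyParity g) → GrundyParity (suc f)
  grundyFuel-suc {f} ih {Q} len mQ = mex≡ (m%2≤1 c) c%2∉values 0∈values
    where
    open Mirrored mQ
    c : ℕ
    c = #fixed Q
    value : Subset n → ℕ
    value x = grundyFuel f (option x Q)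
    fixed-move : ∀ {x} → x ∈ Q → Fixed x → ∃[ c′ ] (suc c′ ≡ c × value x ≡ c′ % 2)
    fixed-move {x} x∈Q fx =
      #fixed (option x Q) ,
      #fixed-option-suc Q unique x∈Q fx (λ y∈Q fy x⊆y → sym (fixed-minimal x∈Q y∈Q fy x⊆y)) ,
      ih ≤-refl (≤-pred (≤-trans (length-option< x∈Q) len)) (mirrored-option-fixed mQ fx)
    value≢ : ∀ {x} → x ∈ Q → value x ≢ c % 2
    value≢ {x} x∈Q with fixed? x
    ... | no  ¬fx = mirror-move≢ (λ g<f → ih (m<n⇒m<1+n g<f)) len mQ x∈Q ¬fx
    ... | yes fx with fixed-move x∈Q fx
    ...   | c′ , c≡ , value≡ = λ value≡c →
      [1+m]%2≢m%2 c′ (trans (cong (_% 2) c≡) (trans (sym value≡c) value≡))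
    c%2∉values : ¬ c % 2 ∈ map value Q
    c%2∉values c%2∈ with ∈-map⁻ value c%2∈
    ... | x , x∈Q , c%2≡ = value≢ x∈Q (sym c%2≡)
    0∈values : c % 2 ≡ 1 → 0 ∈ map value Q
    0∈values c%2≡1 with 0<#fixed⇒∃-fixed Q (m%2≡1⇒0<m c c%2≡1)
    ... | x , x∈Q , fx with fixed-move x∈Q fx
    ...   | c′ , c≡ , value≡ = subst (_∈ map value Q) value≡0 (∈-map⁺ value x∈Q)
      where
      value≡0 : value x ≡ 0
      value≡0 = trans value≡ ([1+m]%2≡1⇒m%2≡0 c′ (trans (cong (_% 2) c≡) c%2≡1))

  grundyFuel-mirrored : ∀ f → GrundyParity f
  grundyFuel-mirrored = <-rec GrundyParity step
    where
    step : ∀ f → (∀ {g} → g < f → GrundyParity g) → GrundyParity f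
    step zero    _  {[]} _ _ = refl
    step (suc f) ih          = grundyFuel-suc ih

  grundy-mirrored : ∀ {Q} → Mirrored Q → grundy Q ≡ #fixed Q % 2
  grundy-mirrored = grundyFuel-mirrored _ ≤-refl

-- Two levels of the Boolean lattice

count-allSubsets-suc : ∀ n (p : Subset (suc n) → Bool) →
                       count p (allSubsets (suc n)) ≡
                       count (λ v → p (outside ∷ v)) (allSubsets n) +
                       count (λ v → p (inside ∷ v)) (allSubsets n)
count-allSubsets-suc n p =
  trans (count-++ p (map (outside ∷_) (allSubsets n)) (map (inside ∷_) (allSubsets n)))
        (cong₂ _+_ (count-map p (outside ∷_) (allSubsets n)) (count-map p (inside ∷_) (allSubsets n)))

∈-allSubsets : ∀ {n} (v : Subset n) → v ∈ allSubsets n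
∈-allSubsets []                  = here refl
∈-allSubsets {suc n} (false ∷ v) = ∈-++⁺ˡ (∈-map⁺ (outside ∷_) (∈-allSubsets v))
∈-allSubsets {suc n} (true ∷ v)  =
  ∈-++⁺ʳ (map (outside ∷_) (allSubsets n)) (∈-map⁺ (inside ∷_) (∈-allSubsets v))

allSubsets-unique : ∀ n → Unique (allSubsets n)
allSubsets-unique zero    = All.[] ∷ []
allSubsets-unique (suc n) =
  ++⁺ (map⁺ Vec.∷-injectiveʳ (allSubsets-unique n)) (map⁺ Vec.∷-injectiveʳ (allSubsets-unique n)) disjoint
  where
  disjoint : ∀ {v} → ¬ (v ∈ map (outside ∷_) (allSubsets n) × v ∈ map (inside ∷_) (allSubsets n))
  disjoint (v∈out , v∈in) with ∈-map⁻ (outside ∷_) v∈out | ∈-map⁻ (inside ∷_) v∈in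
  ... | _ , _ , refl | _ , _ , ()

p⊆q∧∣q∣≤∣p∣⇒p≡q : ∀ {n} {p q : Subset n} → p ⊆ q → ∣ q ∣ ≤ ∣ p ∣ → p ≡ q
p⊆q∧∣q∣≤∣p∣⇒p≡q {p = []}        {[]}        _   _  = refl
p⊆q∧∣q∣≤∣p∣⇒p≡q {p = false ∷ p} {false ∷ q} p⊆q le =
  cong (outside ∷_) (p⊆q∧∣q∣≤∣p∣⇒p≡q (drop-∷-⊆ p⊆q) le)
p⊆q∧∣q∣≤∣p∣⇒p≡q {p = true ∷ p}  {true ∷ q}  p⊆q le =
  cong (inside ∷_) (p⊆q∧∣q∣≤∣p∣⇒p≡q (drop-∷-⊆ p⊆q) (≤-pred le))
p⊆q∧∣q∣≤∣p∣⇒p≡q {p = false ∷ p} {true ∷ q}  p⊆q le =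
  contradiction (≤-trans le (p⊆q⇒∣p∣≤∣q∣ (drop-∷-⊆ p⊆q))) 1+n≰n
p⊆q∧∣q∣≤∣p∣⇒p≡q {p = true ∷ p}  {false ∷ q} p⊆q _  with p⊆q here
... | ()

swapPairs : ∀ {n} → Subset n → Subset n
swapPairs []          = []
swapPairs (a ∷ [])    = a ∷ []
swapPairs (a ∷ b ∷ v) = b ∷ a ∷ swapPairs v

swapPairs-involutive : ∀ {n} (v : Subset n) → swapPairs (swapPairs v) ≡ v
swapPairs-involutive []          = refl
swapPairs-involutive (a ∷ [])    = refl
swapPairs-involutive (a ∷ b ∷ v) = cong (λ w → a ∷ b ∷ w) (swapPairs-involutive v)

∣swapPairs∣ : ∀ {n} (v : Subset n) → ∣ swapPairs v ∣ ≡ ∣ v ∣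
∣swapPairs∣ []                  = refl
∣swapPairs∣ (a ∷ [])            = refl
∣swapPairs∣ (true ∷ true ∷ v)   = cong (λ m → suc (suc m)) (∣swapPairs∣ v)
∣swapPairs∣ (true ∷ false ∷ v)  = cong suc (∣swapPairs∣ v)
∣swapPairs∣ (false ∷ true ∷ v)  = cong suc (∣swapPairs∣ v)
∣swapPairs∣ (false ∷ false ∷ v) = ∣swapPairs∣ v

zero∈-head : ∀ {m n a} {p : Subset m} {q : Subset n} → zero Subset.∈ a ∷ p → zero Subset.∈ a ∷ q
zero∈-head here = here

∷-⊆ : ∀ {n a b} {p q : Subset n} →
      (zero Subset.∈ a ∷ p → zero Subset.∈ b ∷ q) → p ⊆ q → a ∷ p ⊆ b ∷ q
∷-⊆ head⊆ p⊆q here      = head⊆ here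
∷-⊆ head⊆ p⊆q (there i) = there (p⊆q i)

swapPairs-mono : ∀ {n} {x y : Subset n} → x ⊆ y → swapPairs x ⊆ swapPairs y
swapPairs-mono {x = []}        {[]}        x⊆y = x⊆y
swapPairs-mono {x = a ∷ []}    {c ∷ []}    x⊆y = x⊆y
swapPairs-mono {x = a ∷ b ∷ x} {c ∷ d ∷ y} x⊆y =
  ∷-⊆ (λ b∈ → zero∈-head (drop-there (x⊆y (there (zero∈-head b∈)))))
      (∷-⊆ (λ a∈ → zero∈-head (x⊆y (zero∈-head a∈)))
           (swapPairs-mono (drop-∷-⊆ (drop-∷-⊆ x⊆y))))

module PairSwap {n} = Mirror (swapPairs {n}) swapPairs-involutive swapPairs-mono
open PairSwap

fixed⇒2∣size : ∀ q (v : Subset (q * 2)) → Fixed v → 2 ∣ ∣ v ∣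
fixed⇒2∣size zero    []                  _  = divides 0 refl
fixed⇒2∣size (suc q) (true ∷ true ∷ v)   fv
  with fixed⇒2∣size q v (Vec.∷-injectiveʳ (Vec.∷-injectiveʳ fv))
... | divides j ∣v∣≡ = divides (suc j) (cong (λ m → suc (suc m)) ∣v∣≡)
fixed⇒2∣size (suc q) (false ∷ false ∷ v) fv =
  fixed⇒2∣size q v (Vec.∷-injectiveʳ (Vec.∷-injectiveʳ fv))

fixedOfSize : ∀ {n} → ℕ → Subset n → Bool
fixedOfSize K x = does (fixed? x) ∧ does (∣ x ∣ ≟ K)

#fixed-choose : ∀ n K → #fixed (choose n K) ≡ count (fixedOfSize K) (allSubsets n)
#fixed-choose n K = count-filter (λ x → does (fixed? x)) (λ x → ∣ x ∣ ≟ K) (allSubsets n)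

-- A fixed subset contains both or neither of the first two points: the two mixed counts vanish
-- by computation.
count-fixedOfSize-suc : ∀ q K →
  count (fixedOfSize K) (allSubsets (suc q * 2)) ≡
  count (fixedOfSize K) (allSubsets (q * 2)) +
  count (λ v → fixedOfSize K (inside ∷ inside ∷ v)) (allSubsets (q * 2))
count-fixedOfSize-suc q K = begin
  count (fixedOfSize K) (allSubsets (suc q * 2))
    ≡⟨ count-allSubsets-suc (suc (q * 2)) (fixedOfSize K) ⟩
  count (λ v → fixedOfSize K (outside ∷ v)) (allSubsets (suc (q * 2))) +
  count (λ v → fixedOfSize K (inside ∷ v)) (allSubsets (suc (q * 2)))
    ≡⟨ cong₂ _+_ (count-allSubsets-suc (q * 2) _) (count-allSubsets-suc (q * 2) _) ⟩
  (oo + count (λ v → fixedOfSize K (outside ∷ inside ∷ v)) A) +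
  (count (λ v → fixedOfSize K (inside ∷ outside ∷ v)) A + ii)
    ≡⟨ cong₂ (λ a b → (oo + a) + (b + ii)) (count-none _ (λ _ → refl) A)
                                             (count-none _ (λ _ → refl) A) ⟩
  (oo + 0) + ii
    ≡⟨ cong (_+ ii) (+-identityʳ oo) ⟩
  oo + ii ∎
  where
  open ≡-Reasoning
  A : List (Subset (q * 2))
  A  = allSubsets (q * 2)
  oo ii : ℕ
  oo = count (fixedOfSize K) A
  ii = count (λ v → fixedOfSize K (inside ∷ inside ∷ v)) A

count-fixedOfSize-even : ∀ q j → count (fixedOfSize (j * 2)) (allSubsets (q * 2)) ≡ q C j
count-fixedOfSize-even zero    zero    = refl
count-fixedOfSize-even zero    (suc j) = refl
count-fixedOfSize-even (suc q) zero    =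
  trans (count-fixedOfSize-suc q 0)
        (cong₂ _+_ (count-fixedOfSize-even q 0)
                   (count-none _ (λ v → Bool.∧-zeroʳ (does (fixed? v))) (allSubsets (q * 2))))
count-fixedOfSize-even (suc q) (suc j) = begin
  count (fixedOfSize (suc j * 2)) (allSubsets (suc q * 2))
    ≡⟨ count-fixedOfSize-suc q (suc j * 2) ⟩
  count (fixedOfSize (suc j * 2)) A + count (fixedOfSize (j * 2)) A
    ≡⟨ cong₂ _+_ (count-fixedOfSize-even q (suc j)) (count-fixedOfSize-even q j) ⟩
  q C suc j + q C j
    ≡⟨ +-comm (q C suc j) (q C j) ⟩
  q C j + q C suc j
    ≡⟨ nCk+nC[k+1]≡[n+1]C[k+1] q j ⟩
  suc q C suc j ∎
  where
  open ≡-Reasoning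
  A : List (Subset (q * 2))
  A = allSubsets (q * 2)

count-fixedOfSize-odd : ∀ q j → count (fixedOfSize (suc (j * 2))) (allSubsets (q * 2)) ≡ 0
count-fixedOfSize-odd zero    j       = refl
count-fixedOfSize-odd (suc q) zero    =
  trans (count-fixedOfSize-suc q 1)
        (cong₂ _+_ (count-fixedOfSize-odd q 0)
                   (count-none _ (λ v → Bool.∧-zeroʳ (does (fixed? v))) (allSubsets (q * 2))))
count-fixedOfSize-odd (suc q) (suc j) =
  trans (count-fixedOfSize-suc q (suc (suc j * 2)))
        (cong₂ _+_ (count-fixedOfSize-odd q (suc j)) (count-fixedOfSize-odd q j))

#fixed-choose-odd : ∀ q {K} → ¬ 2 ∣ K → #fixed (choose (q * 2) K) ≡ 0
#fixed-choose-odd q {K} K-odd with halving K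
... | even j = contradiction (divides j refl) K-odd
... | odd j  = trans (#fixed-choose (q * 2) (suc (j * 2))) (count-fixedOfSize-odd q j)

parity-#fixed-choose : ∀ q K → parity (#fixed (choose (q * 2) K)) ≡ parity (q * 2 C K)
parity-#fixed-choose q K with halving K
... | even j = trans (cong parity (trans (#fixed-choose (q * 2) (j * 2)) (count-fixedOfSize-even q j)))
                     (sym (parity-[a*2]C[b*2] q j))
... | odd j  = trans (cong parity (trans (#fixed-choose (q * 2) (suc (j * 2))) (count-fixedOfSize-odd q j)))
                     (sym (parity-[a*2]C[1+b*2] q j))

∈-choose⁻ : ∀ {n K x} → x ∈ choose n K → ∣ x ∣ ≡ K
∈-choose⁻ {n} {K} x∈ = proj₂ (∈-filter⁻ (λ s → ∣ s ∣ ≟ K) {xs = allSubsets n} x∈)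

∈-levels⁻ : ∀ {n k k' x} → x ∈ levels n k k' → ∣ x ∣ ≡ k ⊎ ∣ x ∣ ≡ k'
∈-levels⁻ {n} {k} x∈ = Sum.map ∈-choose⁻ ∈-choose⁻ (∈-++⁻ (choose n k) x∈)

∈-levels⁺ : ∀ {n k k'} x → ∣ x ∣ ≡ k ⊎ ∣ x ∣ ≡ k' → x ∈ levels n k k'
∈-levels⁺ {n} {k} {k'} x (inj₁ ∣x∣≡k)  =
  ∈-++⁺ˡ (∈-filter⁺ (λ s → ∣ s ∣ ≟ k) (∈-allSubsets x) ∣x∣≡k)
∈-levels⁺ {n} {k} {k'} x (inj₂ ∣x∣≡k') =
  ∈-++⁺ʳ (choose n k) (∈-filter⁺ (λ s → ∣ s ∣ ≟ k') (∈-allSubsets x) ∣x∣≡k')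

levels-unique : ∀ {n k k'} → k ≢ k' → Unique (levels n k k')
levels-unique {n} {k} {k'} k≢k' =
  ++⁺ (filter⁺ (λ s → ∣ s ∣ ≟ k) (allSubsets-unique n))
      (filter⁺ (λ s → ∣ s ∣ ≟ k') (allSubsets-unique n))
      λ (x∈k , x∈k') → k≢k' (trans (sym (∈-choose⁻ x∈k)) (∈-choose⁻ x∈k'))

levels-mirrored : ∀ q {k k'} → k < k' → ¬ 2 ∣ k' → Mirrored (levels (q * 2) k k')
levels-mirrored q {k} {k'} k<k' k'-odd = record
  { unique        = levels-unique (<⇒≢ k<k')
  ; closed        = λ {x} x∈ → ∈-levels⁺ (swapPairs x) (Sum.map (trans (∣swapPairs∣ x))
                                                                (trans (∣swapPairs∣ x)) (∈-levels⁻ x∈))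
  ; fixed-minimal = fixed-minimal
  ; ⊆σ⇒fixed      = λ {x} _ x⊆σx → sym (p⊆q∧∣q∣≤∣p∣⇒p≡q x⊆σx (≤-reflexive (∣swapPairs∣ x)))
  }
  where
  P : List (Subset (q * 2))
  P = levels (q * 2) k k'
  fixed-minimal : ∀ {x y} → x ∈ P → y ∈ P → Fixed y → x ⊆ y → x ≡ y
  fixed-minimal {x} {y} x∈ y∈ fy x⊆y =
    p⊆q∧∣q∣≤∣p∣⇒p≡q x⊆y (≤-reflexive (trans ∣y∣≡k (sym ∣x∣≡k)))
    where
    ∣y∣≡k : ∣ y ∣ ≡ k
    ∣y∣≡k with ∈-levels⁻ y∈
    ... | inj₁ ∣y∣≡k  = ∣y∣≡k
    ... | inj₂ ∣y∣≡k' = contradiction (subst (2 ∣_) ∣y∣≡k' (fixed⇒2∣size q y fy)) k'-odd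
    ∣x∣≡k : ∣ x ∣ ≡ k
    ∣x∣≡k with ∈-levels⁻ x∈
    ... | inj₁ ∣x∣≡k  = ∣x∣≡k
    ... | inj₂ ∣x∣≡k' = contradiction (subst₂ _≤_ ∣x∣≡k' ∣y∣≡k (p⊆q⇒∣p∣≤∣q∣ x⊆y)) (<⇒≱ k<k')

grundy-levels : ∀ {n k k'} → 2 ∣ n → k < k' → ¬ 2 ∣ k' → grundy (levels n k k') ≡ (n C k) % 2
grundy-levels {k = k} {k'} (divides q refl) k<k' k'-odd = begin
  grundy (levels (q * 2) k k')      ≡⟨ grundy-mirrored (levels-mirrored q k<k' k'-odd) ⟩
  #fixed (levels (q * 2) k k') % 2  ≡⟨ cong (_% 2) #fixed-levels ⟩
  #fixed-k % 2                      ≡⟨ parity≡⇒%2≡ #fixed-k (q * 2 C k) (parity-#fixed-choose q k) ⟩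
  (q * 2 C k) % 2                   ∎
  where
  open ≡-Reasoning
  #fixed-k : ℕ
  #fixed-k = #fixed (choose (q * 2) k)
  #fixed-levels : #fixed (levels (q * 2) k k') ≡ #fixed-k
  #fixed-levels = trans (count-++ _ (choose (q * 2) k) (choose (q * 2) k'))
                        (trans (cong (#fixed-k +_) (#fixed-choose-odd q k'-odd)) (+-identityʳ #fixed-k))

mainTheorem2 : (n k k' : ℕ) → n > 0 → 2 ∣ n → 1 ≤ k → k < k' → k' ≤ n → ¬ (2 ∣ k') →
    ((∃[ i ] (i < n × bit i k > bit i n)) → grundy (levels n k k') ≡ 0)
    × ((¬ (∃[ i ] (i < n × bit i k > bit i n))) → grundy (levels n k k') ≡ 1)
    × (2 ∣ k → grundy (levels n k k') ≡ ((n / 2) C (k / 2)) % 2)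
mainTheorem2 n k k' _ 2∣n _ k<k' k'≤n k'-odd =
  exceeds⇒0 , ¬exceeds⇒1 , λ 2∣k → trans grundy≡ (nCk%2≡[n/2]C[k/2]%2 n k 2∣k)
  where
  Exceeds : Set
  Exceeds = ∃[ i ] (i < n × bit i k > bit i n)
  grundy≡ : grundy (levels n k k') ≡ (n C k) % 2
  grundy≡ = grundy-levels 2∣n k<k' k'-odd
  exceeds⇒0 : Exceeds → grundy (levels n k k') ≡ 0
  exceeds⇒0 (i , _ , bits<) = trans grundy≡ (parity≡⇒%2≡ (n C k) 0 (bit<⇒parity[C]≡0ℙ i n k bits<))
  ¬exceeds⇒1 : ¬ Exceeds → grundy (levels n k k') ≡ 1
  ¬exceeds⇒1 ¬exceeds with parity (n C k) in parity≡
  ... | 1ℙ = trans grundy≡ (parity≡⇒%2≡ (n C k) 1 parity≡)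
  ... | 0ℙ with parity[C]≡0ℙ⇒bit< n k parity≡
  ...   | i , bits< = contradiction (i , i<n , bits<) ¬exceeds
    where
    i<n : i < n
    i<n = <-trans (0<bit⇒< i k (≤-<-trans z≤n bits<)) (<-≤-trans k<k' k'≤n)
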